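{- For $n\geq 1$, the number of edges of the cube-complement $\overline{\Gamma}_n$ of the Fibonacci cube $\Gamma_n$ satisfies $$|E(\overline{\Gamma}_n)|=n2^{n-1}-\sum_{i=1}^{n}F_{i+1}F_{n-i+2}=n2^{n-1}-\frac{4nF_{n+1}+(3n-2)F_n}{5}.$$
   Context: The hypercube $Q_n$ has vertex set the binary strings of length $n$, adjacency meaning differing in exactly one position. $\Gamma_n$ is the subgraph of $Q_n$ induced by binary strings with no two consecutive 1's, and $\overline{\Gamma}_n$ is the subgraph of $Q_n$ induced by the binary strings of length $n$ containing $11$ as a substring. $F_n$ is the Fibonacci sequence $F_0=0$, $F_1=1$, $F_n=F_{n-1}+F_{n-2}$. -}

module Defs where

open import Data.Bool using (Bool; true; false; _∧_; _∨_; if_then_else_)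
open import Data.Nat using (ℕ; zero; suc; _+_; _*_)
open import Data.List using (List; []; _∷_; map; filter; length; concatMap; applyUpTo)
open import Data.Nat.ListAction using (sum)
open import Data.Product using (_×_; _,_)
open import Data.Vec using (Vec; []; _∷_)
open import Relation.Nullary.Decidable using (Dec; yes; no; T?)
open import Data.Bool using (T)

F : ℕ → ℕ
F zero = 0
F (suc zero) = 1
F (suc (suc n)) = F (suc n) + F n

allStrings : (n : ℕ) → List (Vec Bool n)
allStrings zero = [] ∷ []
allStrings (suc n) = map (false ∷_) (allStrings n) Data.List.++ map (true ∷_) (allStrings n)

has11 : ∀ {n} → Vec Bool n → Bool
has11 [] = false
has11 (_ ∷ []) = false
has11 (a ∷ b ∷ xs) = (a ∧ b) ∨ has11 (b ∷ xs)

hamming : ∀ {n} → Vec Bool n → Vec Bool n → ℕ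
hamming [] [] = 0
hamming (a ∷ xs) (b ∷ ys) = (if (a Data.Bool.xor b) then 1 else 0) + hamming xs ys

-- strict lexicographic order (false < true), used to count each unordered pair once
lexLt : ∀ {n} → Vec Bool n → Vec Bool n → Bool
lexLt [] [] = false
lexLt (false ∷ xs) (false ∷ ys) = lexLt xs ys
lexLt (true ∷ xs) (true ∷ ys) = lexLt xs ys
lexLt (false ∷ xs) (true ∷ ys) = true
lexLt (true ∷ xs) (false ∷ ys) = false

isOne : ℕ → Bool
isOne (suc zero) = true
isOne _ = false

-- vertices of the induced subgraph of Q n on strings containing 11
complVertices : (n : ℕ) → List (Vec Bool n)
complVertices n = filter (λ v → T? (has11 v)) (allStrings n)

complEdges : (n : ℕ) → List (Vec Bool n × Vec Bool n)
complEdges n = concatMap (λ u → map (u ,_) (filter (λ v → T? (isOne (hamming u v) ∧ lexLt u v)) (complVertices n))) (complVertices n)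

numEdgesCompl : ℕ → ℕ
numEdgesCompl n = length (complEdges n)

sumFrom1 : ℕ → (ℕ → ℕ) → ℕ
sumFrom1 n f = sum (applyUpTo (λ k → f (suc k)) n)

{-# OPTIONS --safe #-}
-- Splitting Qₙ₊₁ by the first bit into the halves 0Qₙ and 1Qₙ, joined by the rungs 0u–1u, the
-- edges of the subgraph induced by a predicate P are those induced in each half plus the rungs
-- with both ends in P. For "contains 11" (eₙ edges) and "1x contains 11" (wₙ edges) this gives
--   eₙ₊₁ = eₙ + cₙ + wₙ,   wₙ₊₁ = eₙ + cₙ + qₙ,
-- where cₙ = 2ⁿ − Fₙ₊₂ counts the strings containing 11 and qₙ = n2ⁿ⁻¹ = |E(Qₙ)|. The sums
-- Sₙ = Σᵢ Fᵢ₊₁Fₙ₊₂₋ᵢ and Tₙ = Σᵢ Fᵢ₊₁Fₙ₊₁₋ᵢ obey Sₙ₊₁ = Sₙ + Tₙ + Fₙ₊₂ and Tₙ₊₁ = Sₙ + Fₙ₊₂, so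
-- eₙ + Sₙ = qₙ = wₙ + Tₙ by a joint induction; a joint induction on (Sₙ, Tₙ) gives the closed form.
module Submission where

open import Defs
open import Data.Nat using (ℕ; suc; _+_; _*_; _∸_; _^_; _≥_)
open import Data.Product using (_×_)
open import Relation.Binary.PropositionalEquality using (_≡_)

open import Data.Bool using (Bool; true; false; _∧_; if_then_else_)
open import Data.Bool.Properties using (∧-zeroʳ; ∧-identityʳ; ∨-zeroʳ)
open import Data.List using (List; []; _∷_; map; filter; length; concatMap; _++_)
open import Data.List.Properties using (length-++; length-map; map-++; map-∘; map-cong)
open import Data.Nat using (zero; _≤_; z≤n; s≤s)
open import Data.Nat.ListAction using (sum)
open import Data.Nat.ListAction.Properties using (sum-++)
open import Data.Nat.Properties
  using (+-assoc; +-comm; +-identityʳ; *-identityʳ; *-distribˡ-+; ≤-trans; m≤n⇒m≤1+n; n≤1+n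
        ; +-∸-assoc; +-∸-comm; m+n∸n≡m)
open import Data.Nat.Tactic.RingSolver using (solve-∀)
open import Data.Product using (_,_; proj₁)
open import Data.Vec using (Vec; []; _∷_)
open import Function using (_∘_; const)
open import Relation.Nullary.Decidable using (T?)
open import Relation.Binary.PropositionalEquality using (refl; sym; trans; cong; cong₂; module ≡-Reasoning)

indicator : Bool → ℕ
indicator true = 1
indicator false = 0

if-indicator : ∀ a b → (if a then indicator b else 0) ≡ indicator (a ∧ b)
if-indicator true b = refl
if-indicator false b = refl

length-concatMap : ∀ {A B : Set} (f : A → List B) (xs : List A) →
  length (concatMap f xs) ≡ sum (map (length ∘ f) xs)
length-concatMap f [] = refl
length-concatMap f (x ∷ xs) = trans (length-++ (f x)) (cong (length (f x) +_) (length-concatMap f xs))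

length-filter : ∀ {A : Set} (p : A → Bool) (xs : List A) →
  length (filter (λ x → T? (p x)) xs) ≡ sum (map (indicator ∘ p) xs)
length-filter p [] = refl
length-filter p (x ∷ xs) with p x
... | true = cong suc (length-filter p xs)
... | false = length-filter p xs

sum-map-filter : ∀ {A : Set} (p : A → Bool) (g : A → ℕ) (xs : List A) →
  sum (map g (filter (λ x → T? (p x)) xs)) ≡ sum (map (λ x → if p x then g x else 0) xs)
sum-map-filter p g [] = refl
sum-map-filter p g (x ∷ xs) with p x
... | true = cong (g x +_) (sum-map-filter p g xs)
... | false = sum-map-filter p g xs

cubeSum : (n : ℕ) → (Vec Bool n → ℕ) → ℕ
cubeSum zero g = g []
cubeSum (suc n) g = cubeSum n (g ∘ (false ∷_)) + cubeSum n (g ∘ (true ∷_))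

cubeSum-cong : ∀ n {g h : Vec Bool n → ℕ} → (∀ x → g x ≡ h x) → cubeSum n g ≡ cubeSum n h
cubeSum-cong zero g≗h = g≗h []
cubeSum-cong (suc n) g≗h = cong₂ _+_ (cubeSum-cong n (g≗h ∘ (false ∷_))) (cubeSum-cong n (g≗h ∘ (true ∷_)))

cubeSum-+ : ∀ n (g h : Vec Bool n → ℕ) → cubeSum n (λ x → g x + h x) ≡ cubeSum n g + cubeSum n h
cubeSum-+ zero g h = refl
cubeSum-+ (suc n) g h = trans
  (cong₂ _+_ (cubeSum-+ n (g ∘ (false ∷_)) (h ∘ (false ∷_))) (cubeSum-+ n (g ∘ (true ∷_)) (h ∘ (true ∷_))))
  (interchange (cubeSum n (g ∘ (false ∷_))) _ _ _)
  where
    interchange : ∀ a b c d → (a + b) + (c + d) ≡ (a + c) + (b + d)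
    interchange = solve-∀

cubeSum-zero : ∀ n {g : Vec Bool n → ℕ} → (∀ x → g x ≡ 0) → cubeSum n g ≡ 0
cubeSum-zero zero g≗0 = g≗0 []
cubeSum-zero (suc n) g≗0 = cong₂ _+_ (cubeSum-zero n (g≗0 ∘ (false ∷_))) (cubeSum-zero n (g≗0 ∘ (true ∷_)))

sum-map-allStrings : ∀ n (g : Vec Bool n → ℕ) → sum (map g (allStrings n)) ≡ cubeSum n g
sum-map-allStrings zero g = +-identityʳ (g [])
sum-map-allStrings (suc n) g = begin
    sum (map g (map (false ∷_) (allStrings n) ++ map (true ∷_) (allStrings n)))
  ≡⟨ cong sum (map-++ g (map (false ∷_) (allStrings n)) _) ⟩
    sum (map g (map (false ∷_) (allStrings n)) ++ map g (map (true ∷_) (allStrings n)))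
  ≡⟨ sum-++ (map g (map (false ∷_) (allStrings n))) _ ⟩
    sum (map g (map (false ∷_) (allStrings n))) + sum (map g (map (true ∷_) (allStrings n)))
  ≡⟨ cong₂ _+_ (cong sum (sym (map-∘ (allStrings n)))) (cong sum (sym (map-∘ (allStrings n)))) ⟩
    sum (map (g ∘ (false ∷_)) (allStrings n)) + sum (map (g ∘ (true ∷_)) (allStrings n))
  ≡⟨ cong₂ _+_ (sum-map-allStrings n (g ∘ (false ∷_))) (sum-map-allStrings n (g ∘ (true ∷_))) ⟩
    cubeSum (suc n) g
  ∎
  where open ≡-Reasoning

count : (n : ℕ) → (Vec Bool n → Bool) → ℕ
count n P = cubeSum n (indicator ∘ P)

count-cong : ∀ n {P Q : Vec Bool n → Bool} → (∀ x → P x ≡ Q x) → count n P ≡ count n Q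
count-cong n P≗Q = cubeSum-cong n (cong indicator ∘ P≗Q)

count-true : ∀ n → count n (const true) ≡ 2 ^ n
count-true zero = refl
count-true (suc n) = trans (cong₂ _+_ (count-true n) (count-true n)) (cong (2 ^ n +_) (sym (+-identityʳ (2 ^ n))))

isEdge : ∀ {n} → Vec Bool n → Vec Bool n → Bool
isEdge u v = isOne (hamming u v) ∧ lexLt u v

edgeCount : (n : ℕ) → (Vec Bool n → Bool) → ℕ
edgeCount n P = cubeSum n (λ u → cubeSum n (λ v → indicator (P u ∧ P v ∧ isEdge u v)))

edgeCount-cong : ∀ n {P Q : Vec Bool n → Bool} → (∀ x → P x ≡ Q x) → edgeCount n P ≡ edgeCount n Q
edgeCount-cong n P≗Q =
  cubeSum-cong n (λ u → cubeSum-cong n (λ v → cong₂ (λ a b → indicator (a ∧ b ∧ isEdge u v)) (P≗Q u) (P≗Q v)))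

numEdgesCompl≡edgeCount : ∀ n → numEdgesCompl n ≡ edgeCount n has11
numEdgesCompl≡edgeCount n = begin
    numEdgesCompl n
  ≡⟨ length-concatMap (λ u → map (u ,_) (filter (λ v → T? (isEdge u v)) V)) V ⟩
    sum (map (λ u → length (map (u ,_) (filter (λ v → T? (isEdge u v)) V))) V)
  ≡⟨ cong sum (map-cong outerLength V) ⟩
    sum (map (λ u → sum (map (indicator ∘ isEdge u) V)) V)
  ≡⟨ sum-map-filter has11 _ (allStrings n) ⟩
    sum (map (λ u → if has11 u then sum (map (indicator ∘ isEdge u) V) else 0) (allStrings n))
  ≡⟨ sum-map-allStrings n _ ⟩
    cubeSum n (λ u → if has11 u then sum (map (indicator ∘ isEdge u) V) else 0)
  ≡⟨ cubeSum-cong n (λ u → cong (λ k → if has11 u then k else 0) (innerSum u)) ⟩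
    cubeSum n (λ u → if has11 u then count n (λ v → has11 v ∧ isEdge u v) else 0)
  ≡⟨ cubeSum-cong n (λ u → guard (has11 u) (λ v → has11 v ∧ isEdge u v)) ⟩
    edgeCount n has11
  ∎
  where
    open ≡-Reasoning
    V : List (Vec Bool n)
    V = complVertices n
    outerLength : ∀ u →
      length (map (u ,_) (filter (λ v → T? (isEdge u v)) V)) ≡ sum (map (indicator ∘ isEdge u) V)
    outerLength u = trans (length-map (u ,_) (filter (λ v → T? (isEdge u v)) V)) (length-filter (isEdge u) V)
    innerSum : ∀ u → sum (map (indicator ∘ isEdge u) V) ≡ count n (λ v → has11 v ∧ isEdge u v)
    innerSum u = trans (sum-map-filter has11 (indicator ∘ isEdge u) (allStrings n))
      (trans (sum-map-allStrings n _) (cubeSum-cong n (λ v → if-indicator (has11 v) (isEdge u v))))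
    guard : ∀ a (h : Vec Bool n → Bool) → (if a then count n h else 0) ≡ count n (λ v → a ∧ h v)
    guard true h = refl
    guard false h = sym (cubeSum-zero n (λ _ → refl))

indicator-∧-false : ∀ a b → indicator (a ∧ b ∧ false) ≡ 0
indicator-∧-false a b rewrite ∧-zeroʳ b | ∧-zeroʳ a = refl

noBackwardEdge : ∀ {n} a b (u v : Vec Bool n) → indicator (a ∧ b ∧ isEdge (true ∷ u) (false ∷ v)) ≡ 0
noBackwardEdge a b u v = trans (cong (λ e → indicator (a ∧ b ∧ e)) (∧-zeroʳ _)) (indicator-∧-false a b)

-- The only neighbour of 0u in the half 1Qₙ is 1u.
rungCount : ∀ {n} a (Q : Vec Bool n → Bool) (u : Vec Bool n) →
  cubeSum n (λ v → indicator (a ∧ Q v ∧ isEdge (false ∷ u) (true ∷ v))) ≡ indicator (a ∧ Q u)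
rungCount a Q [] = cong (λ b → indicator (a ∧ b)) (∧-identityʳ (Q []))
rungCount {suc n} a Q (false ∷ u) = trans
  (cong₂ _+_ (rungCount a (Q ∘ (false ∷_)) u) (cubeSum-zero n (λ v → indicator-∧-false a (Q (true ∷ v)))))
  (+-identityʳ _)
rungCount {suc n} a Q (true ∷ u) =
  cong₂ _+_ (cubeSum-zero n (λ v → indicator-∧-false a (Q (false ∷ v)))) (rungCount a (Q ∘ (true ∷_)) u)

edgeCount-suc : ∀ n (P : Vec Bool (suc n) → Bool) →
  edgeCount (suc n) P
    ≡ edgeCount n (P ∘ (false ∷_))
      + count n (λ u → P (false ∷ u) ∧ P (true ∷ u))
      + edgeCount n (P ∘ (true ∷_))
edgeCount-suc n P = begin
    edgeCount (suc n) P
  ≡⟨ cong₂ _+_ (cubeSum-+ n (λ u → edgesInto (false ∷ u) false) (λ u → edgesInto (false ∷ u) true))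
               (cubeSum-+ n (λ u → edgesInto (true ∷ u) false) (λ u → edgesInto (true ∷ u) true)) ⟩
    (edgeCount n P₀ + cubeSum n (λ u → edgesInto (false ∷ u) true))
      + (cubeSum n (λ u → edgesInto (true ∷ u) false) + edgeCount n P₁)
  ≡⟨ cong₂ _+_ (cong (edgeCount n P₀ +_) (cubeSum-cong n (λ u → rungCount (P₀ u) P₁ u)))
               (cong (_+ edgeCount n P₁)
                     (cubeSum-zero n (λ u → cubeSum-zero n (λ v → noBackwardEdge (P₁ u) (P₀ v) u v)))) ⟩
    (edgeCount n P₀ + count n (λ u → P₀ u ∧ P₁ u)) + edgeCount n P₁
  ∎
  where
    open ≡-Reasoning
    P₀ P₁ : Vec Bool n → Bool
    P₀ = P ∘ (false ∷_)
    P₁ = P ∘ (true ∷_)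
    edgesInto : Vec Bool (suc n) → Bool → ℕ
    edgesInto u b = cubeSum n (λ v → indicator (P u ∧ P (b ∷ v) ∧ isEdge u (b ∷ v)))

edgeCount-true : ∀ m → edgeCount (suc m) (const true) ≡ suc m * 2 ^ m
edgeCount-true zero = refl
edgeCount-true (suc m) = begin
    edgeCount (2 + m) (const true)
  ≡⟨ edgeCount-suc (suc m) (const true) ⟩
    edgeCount (suc m) (const true) + count (suc m) (const true) + edgeCount (suc m) (const true)
  ≡⟨ cong₂ (λ a b → a + b + a) (edgeCount-true m) (count-true (suc m)) ⟩
    suc m * 2 ^ m + 2 * 2 ^ m + suc m * 2 ^ m
  ≡⟨ doubling m (2 ^ m) ⟩
    (2 + m) * 2 ^ suc m
  ∎
  where
    open ≡-Reasoning
    doubling : ∀ m p → (1 + m) * p + 2 * p + (1 + m) * p ≡ (2 + m) * (2 * p)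
    doubling = solve-∀

has11-0∷ : ∀ {n} (x : Vec Bool n) → has11 (false ∷ x) ≡ has11 x
has11-0∷ [] = refl
has11-0∷ (b ∷ x) = refl

has11-0∷∧1∷ : ∀ {n} (x : Vec Bool n) → has11 (false ∷ x) ∧ has11 (true ∷ x) ≡ has11 x
has11-0∷∧1∷ [] = refl
has11-0∷∧1∷ (b ∷ x) with has11 (b ∷ x)
... | true = ∨-zeroʳ b
... | false = refl

count-has11 : ∀ n → (count n has11 + F (2 + n) ≡ 2 ^ n) × (count n (has11 ∘ (true ∷_)) + F (1 + n) ≡ 2 ^ n)
count-has11 zero = refl , refl
count-has11 (suc n) with count-has11 n
... | a+F≡2ⁿ , b+F≡2ⁿ = a′+F≡2ⁿ⁺¹ , b′+F≡2ⁿ⁺¹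
  where
    open ≡-Reasoning
    a b : ℕ
    a = count n has11
    b = count n (has11 ∘ (true ∷_))
    a-0∷ : count n (has11 ∘ (false ∷_)) ≡ a
    a-0∷ = count-cong n has11-0∷
    shuffle : ∀ a b c d → (a + b) + (c + d) ≡ (a + c) + (b + d)
    shuffle = solve-∀
    swap : ∀ a p f → a + p + f ≡ (a + f) + (p + 0)
    swap = solve-∀
    a′+F≡2ⁿ⁺¹ : count (suc n) has11 + F (3 + n) ≡ 2 ^ suc n
    a′+F≡2ⁿ⁺¹ = begin
        count (suc n) has11 + F (3 + n)
      ≡⟨ cong (λ x → x + b + F (3 + n)) a-0∷ ⟩
        (a + b) + (F (2 + n) + F (1 + n))
      ≡⟨ shuffle a b (F (2 + n)) (F (1 + n)) ⟩
        (a + F (2 + n)) + (b + F (1 + n))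
      ≡⟨ cong₂ _+_ a+F≡2ⁿ (trans b+F≡2ⁿ (sym (+-identityʳ _))) ⟩
        2 ^ suc n
      ∎
    b′+F≡2ⁿ⁺¹ : count (suc n) (has11 ∘ (true ∷_)) + F (2 + n) ≡ 2 ^ suc n
    b′+F≡2ⁿ⁺¹ = begin
        count (suc n) (has11 ∘ (true ∷_)) + F (2 + n)
      ≡⟨ cong₂ (λ x y → x + y + F (2 + n)) a-0∷ (count-true n) ⟩
        a + 2 ^ n + F (2 + n)
      ≡⟨ swap a (2 ^ n) (F (2 + n)) ⟩
        (a + F (2 + n)) + (2 ^ n + 0)
      ≡⟨ cong (_+ (2 ^ n + 0)) a+F≡2ⁿ ⟩
        2 ^ suc n
      ∎

sumFrom1-cong : ∀ n {f g : ℕ → ℕ} → (∀ {i} → 1 ≤ i → i ≤ n → f i ≡ g i) → sumFrom1 n f ≡ sumFrom1 n g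
sumFrom1-cong zero f≗g = refl
sumFrom1-cong (suc n) f≗g =
  cong₂ _+_ (f≗g (s≤s z≤n) (s≤s z≤n)) (sumFrom1-cong n (λ _ i≤n → f≗g (s≤s z≤n) (s≤s i≤n)))

sumFrom1-+ : ∀ n (f g : ℕ → ℕ) → sumFrom1 n (λ i → f i + g i) ≡ sumFrom1 n f + sumFrom1 n g
sumFrom1-+ zero f g = refl
sumFrom1-+ (suc n) f g = trans (cong (f 1 + g 1 +_) (sumFrom1-+ n (f ∘ suc) (g ∘ suc))) (interchange (f 1) (g 1) _ _)
  where
    interchange : ∀ a b c d → (a + b) + (c + d) ≡ (a + c) + (b + d)
    interchange = solve-∀

sumFrom1-suc : ∀ n (f : ℕ → ℕ) → sumFrom1 (suc n) f ≡ sumFrom1 n f + f (suc n)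
sumFrom1-suc zero f = +-identityʳ (f 1)
sumFrom1-suc (suc n) f = trans (cong (f 1 +_) (sumFrom1-suc n (f ∘ suc))) (sym (+-assoc (f 1) _ _))

fibConv : ℕ → ℕ → ℕ
fibConv m n = sumFrom1 n (λ i → F (suc i) * F (m ∸ i))

fibConv-rec : ∀ {m n} → n ≤ m → fibConv (2 + m) n ≡ fibConv (1 + m) n + fibConv m n
fibConv-rec {m} {n} n≤m =
  trans (sumFrom1-cong n split) (sumFrom1-+ n (λ i → F (suc i) * F (1 + m ∸ i)) (λ i → F (suc i) * F (m ∸ i)))
  where
    split : ∀ {i} → 1 ≤ i → i ≤ n →
      F (suc i) * F (2 + m ∸ i) ≡ F (suc i) * F (1 + m ∸ i) + F (suc i) * F (m ∸ i)
    split {i} _ i≤n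
      rewrite +-∸-assoc 1 (m≤n⇒m≤1+n (≤-trans i≤n n≤m)) | +-∸-assoc 1 (≤-trans i≤n n≤m)
      = *-distribˡ-+ (F (suc i)) (F (suc (m ∸ i))) (F (m ∸ i))

fibConv-step₁ : ∀ n → fibConv (2 + n) (1 + n) ≡ fibConv (2 + n) n + F (2 + n)
fibConv-step₁ n = trans (sumFrom1-suc n (λ i → F (suc i) * F (2 + n ∸ i))) (cong (fibConv (2 + n) n +_) lastTerm)
  where
    lastTerm : F (2 + n) * F (2 + n ∸ suc n) ≡ F (2 + n)
    lastTerm = trans (cong (λ k → F (2 + n) * F k) (m+n∸n≡m 1 n)) (*-identityʳ _)

fibConv-step₂ : ∀ n → fibConv (3 + n) (1 + n) ≡ fibConv (2 + n) n + fibConv (1 + n) n + F (2 + n)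
fibConv-step₂ n =
  trans (sumFrom1-suc n (λ i → F (suc i) * F (3 + n ∸ i))) (cong₂ _+_ (fibConv-rec (n≤1+n n)) lastTerm)
  where
    lastTerm : F (2 + n) * F (3 + n ∸ suc n) ≡ F (2 + n)
    lastTerm = trans (cong (λ k → F (2 + n) * F k) (m+n∸n≡m 2 n)) (*-identityʳ _)

fibConv-closed : ∀ m →
    (5 * fibConv (3 + m) (1 + m) ≡ 4 * (1 + m) * F (2 + m) + (3 * m + 1) * F (1 + m))
  × (5 * fibConv (2 + m) (1 + m) ≡ 3 * (1 + m) * F (2 + m) + (2 + m) * F (1 + m))
fibConv-closed zero = refl , refl
fibConv-closed (suc m) with fibConv-closed m
... | IH₃ , IH₂ = closed₃ , closed₂
  where
    open ≡-Reasoning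
    A B x y : ℕ
    A = fibConv (3 + m) (1 + m)
    B = fibConv (2 + m) (1 + m)
    x = F m
    y = F (1 + m)
    5*-distrib : ∀ a b f → 5 * (a + b + f) ≡ 5 * a + 5 * b + 5 * f
    5*-distrib = solve-∀
    identity₃ : ∀ m x y →
      4 * (1 + m) * (y + x) + (3 * m + 1) * y + (3 * (1 + m) * (y + x) + (2 + m) * y) + 5 * ((y + x) + y)
        ≡ 4 * (2 + m) * ((y + x) + y) + (3 * (1 + m) + 1) * (y + x)
    identity₃ = solve-∀
    identity₂ : ∀ m x y →
      4 * (1 + m) * (y + x) + (3 * m + 1) * y + 5 * ((y + x) + y)
        ≡ 3 * (2 + m) * ((y + x) + y) + (3 + m) * (y + x)
    identity₂ = solve-∀
    closed₃ : 5 * fibConv (4 + m) (2 + m) ≡ 4 * (2 + m) * F (3 + m) + (3 * (1 + m) + 1) * F (2 + m)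
    closed₃ = begin
        5 * fibConv (4 + m) (2 + m)
      ≡⟨ cong (5 *_) (fibConv-step₂ (suc m)) ⟩
        5 * (A + B + F (3 + m))
      ≡⟨ 5*-distrib A B (F (3 + m)) ⟩
        5 * A + 5 * B + 5 * F (3 + m)
      ≡⟨ cong₂ (λ a b → a + b + 5 * F (3 + m)) IH₃ IH₂ ⟩
        4 * (1 + m) * F (2 + m) + (3 * m + 1) * y + (3 * (1 + m) * F (2 + m) + (2 + m) * y) + 5 * F (3 + m)
      ≡⟨ identity₃ m x y ⟩
        4 * (2 + m) * F (3 + m) + (3 * (1 + m) + 1) * F (2 + m)
      ∎
    closed₂ : 5 * fibConv (3 + m) (2 + m) ≡ 3 * (2 + m) * F (3 + m) + (3 + m) * F (2 + m)
    closed₂ = begin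
        5 * fibConv (3 + m) (2 + m)
      ≡⟨ cong (5 *_) (fibConv-step₁ (suc m)) ⟩
        5 * (A + F (3 + m))
      ≡⟨ *-distribˡ-+ 5 A (F (3 + m)) ⟩
        5 * A + 5 * F (3 + m)
      ≡⟨ cong (_+ 5 * F (3 + m)) IH₃ ⟩
        4 * (1 + m) * F (2 + m) + (3 * m + 1) * y + 5 * F (3 + m)
      ≡⟨ identity₂ m x y ⟩
        3 * (2 + m) * F (3 + m) + (3 + m) * F (2 + m)
      ∎

sumFrom1-fib≡fibConv : ∀ n → sumFrom1 n (λ i → F (i + 1) * F (n ∸ i + 2)) ≡ fibConv (2 + n) n
sumFrom1-fib≡fibConv n = sumFrom1-cong n reindex
  where
    reindex : ∀ {i} → 1 ≤ i → i ≤ n → F (i + 1) * F (n ∸ i + 2) ≡ F (suc i) * F (2 + n ∸ i)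
    reindex {i} _ i≤n = cong₂ (λ a b → F a * F b) (+-comm i 1)
      (trans (sym (+-∸-comm 2 i≤n)) (cong (_∸ i) (+-comm n 2)))

-- fibConv (2 + n) n counts the edges of Qₙ with an endpoint in Γₙ, and fibConv (1 + n) n those
-- x–y with 1x or 1y in Γₙ₊₁.
edgeCount-has11 : ∀ n →
    (edgeCount n has11 + fibConv (2 + n) n ≡ edgeCount n (const true))
  × (edgeCount n (has11 ∘ (true ∷_)) + fibConv (1 + n) n ≡ edgeCount n (const true))
edgeCount-has11 zero = refl , refl
edgeCount-has11 (suc n) with edgeCount-has11 n | count-has11 n
... | e+S≡q , w+T≡q | c+F≡2ⁿ , _ = e′+S′≡q′ , w′+T′≡q′
  where
    open ≡-Reasoning
    e w q c S T f : ℕ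
    e = edgeCount n has11
    w = edgeCount n (has11 ∘ (true ∷_))
    q = edgeCount n (const true)
    c = count n has11
    S = fibConv (2 + n) n
    T = fibConv (1 + n) n
    f = F (2 + n)
    e-step : edgeCount (suc n) has11 ≡ e + c + w
    e-step = trans (edgeCount-suc n has11)
      (cong₂ (λ a b → a + b + w) (edgeCount-cong n has11-0∷) (count-cong n has11-0∷∧1∷))
    w-step : edgeCount (suc n) (has11 ∘ (true ∷_)) ≡ e + c + q
    w-step = trans (edgeCount-suc n (has11 ∘ (true ∷_)))
      (cong₂ (λ a b → a + b + q) (edgeCount-cong n has11-0∷)
                                 (count-cong n (λ u → trans (∧-identityʳ _) (has11-0∷ u))))
    q-step : edgeCount (suc n) (const true) ≡ q + 2 ^ n + q
    q-step = trans (edgeCount-suc n (const true)) (cong (λ k → q + k + q) (count-true n))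
    regroup₃ : ∀ e c w S T f → (e + c + w) + (S + T + f) ≡ (e + S) + (c + f) + (w + T)
    regroup₃ = solve-∀
    regroup₂ : ∀ e c q S f → (e + c + q) + (S + f) ≡ (e + S) + (c + f) + q
    regroup₂ = solve-∀
    e′+S′≡q′ : edgeCount (suc n) has11 + fibConv (3 + n) (1 + n) ≡ edgeCount (suc n) (const true)
    e′+S′≡q′ = begin
        edgeCount (suc n) has11 + fibConv (3 + n) (1 + n)
      ≡⟨ cong₂ _+_ e-step (fibConv-step₂ n) ⟩
        (e + c + w) + (S + T + f)
      ≡⟨ regroup₃ e c w S T f ⟩
        (e + S) + (c + f) + (w + T)
      ≡⟨ cong₂ (λ a b → a + (c + f) + b) e+S≡q w+T≡q ⟩
        q + (c + f) + q
      ≡⟨ cong (λ k → q + k + q) c+F≡2ⁿ ⟩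
        q + 2 ^ n + q
      ≡⟨ sym q-step ⟩
        edgeCount (suc n) (const true)
      ∎
    w′+T′≡q′ : edgeCount (suc n) (has11 ∘ (true ∷_)) + fibConv (2 + n) (1 + n) ≡ edgeCount (suc n) (const true)
    w′+T′≡q′ = begin
        edgeCount (suc n) (has11 ∘ (true ∷_)) + fibConv (2 + n) (1 + n)
      ≡⟨ cong₂ _+_ w-step (fibConv-step₁ n) ⟩
        (e + c + q) + (S + f)
      ≡⟨ regroup₂ e c q S f ⟩
        (e + S) + (c + f) + q
      ≡⟨ cong₂ (λ a b → a + b + q) e+S≡q c+F≡2ⁿ ⟩
        q + 2 ^ n + q
      ≡⟨ sym q-step ⟩
        edgeCount (suc n) (const true)
      ∎

mainTheorem14 : (n : ℕ) → n ≥ 1 →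
    (numEdgesCompl n + sumFrom1 n (λ i → F (i + 1) * F (n ∸ i + 2)) ≡ n * 2 ^ (n ∸ 1))
    × (5 * sumFrom1 n (λ i → F (i + 1) * F (n ∸ i + 2)) ≡ 4 * n * F (n + 1) + (3 * n ∸ 2) * F n)
mainTheorem14 (suc m) _ = edges , closedForm
  where
    open ≡-Reasoning
    edges : numEdgesCompl (suc m) + sumFrom1 (suc m) (λ i → F (i + 1) * F (suc m ∸ i + 2)) ≡ suc m * 2 ^ m
    edges = begin
        numEdgesCompl (suc m) + sumFrom1 (suc m) (λ i → F (i + 1) * F (suc m ∸ i + 2))
      ≡⟨ cong₂ _+_ (numEdgesCompl≡edgeCount (suc m)) (sumFrom1-fib≡fibConv (suc m)) ⟩
        edgeCount (suc m) has11 + fibConv (3 + m) (suc m)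
      ≡⟨ proj₁ (edgeCount-has11 (suc m)) ⟩
        edgeCount (suc m) (const true)
      ≡⟨ edgeCount-true m ⟩
        suc m * 2 ^ m
      ∎
    3[1+k]≡2+[3k+1] : ∀ k → 3 * (1 + k) ≡ 2 + (3 * k + 1)
    3[1+k]≡2+[3k+1] = solve-∀
    closedForm : 5 * sumFrom1 (suc m) (λ i → F (i + 1) * F (suc m ∸ i + 2))
                   ≡ 4 * suc m * F (suc m + 1) + (3 * suc m ∸ 2) * F (suc m)
    closedForm = begin
        5 * sumFrom1 (suc m) (λ i → F (i + 1) * F (suc m ∸ i + 2))
      ≡⟨ cong (5 *_) (sumFrom1-fib≡fibConv (suc m)) ⟩
        5 * fibConv (3 + m) (suc m)
      ≡⟨ proj₁ (fibConv-closed m) ⟩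
        4 * suc m * F (2 + m) + (3 * m + 1) * F (suc m)
      ≡⟨ sym (cong₂ (λ k l → 4 * suc m * F k + (l ∸ 2) * F (suc m)) (+-comm (suc m) 1) (3[1+k]≡2+[3k+1] m)) ⟩
        4 * suc m * F (suc m + 1) + (3 * suc m ∸ 2) * F (suc m)
      ∎
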